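{- Let $w\in\mathfrak{S}_N$ and suppose that $w$ has an $N$-occurrence of $4321$. If there exist distinct $k,k'\in\mathrm{newrep}(w)$ with $\mathfrak{p}_k(w)=\mathfrak{p}_{k'}(w)$, then there exist two further distinct $N$-occurrences of $321$ in $w$, neither of which is equal to $\mathfrak{p}_j(w)$ for any $j\in\mathrm{newrep}(w)$.
   Context: Permutations are written in one-line notation; $s_i$ is the simple reflection interchanging $i$ and $i+1$; $\mathrm{supp}(u)$ is the set of distinct simple reflections appearing in a reduced decomposition of $u$. An occurrence of a pattern $p\in\mathfrak{S}_k$ in $w$ is a subsequence $w(i_1)\cdots w(i_k)$, $i_1<\cdots<i_k$, in the same relative order as $p$; it is identified with its set of values $\{w(i_1),\dots,w(i_k)\}$, and is an $N$-occurrence if its largest value is $N$. For $w\in\mathfrak{S}_N$, $\overline{w}\in\mathfrak{S}_{N-1}$ is obtained by deleting the letter $N$ from the one-line notation of $w$. For $u\in\mathfrak{S}_n$ and $1\le k\le n-1$, $M_k(u)=\max\{u(1),\dots,u(k)\}$, $m_k(u)=\min\{u(k+1),\dots,u(n)\}$; write $M_k=M_k(\overline{w})$, $m_k=m_k(\overline{w})$. Let $\mathrm{newrep}(w)=\{k:\ s_k\in\mathrm{supp}(\overline{w}),\ w^{ -1}(N)\le k\}$. For $k\in\mathrm{newrep}(w)$ define: (I) if $w^{ -1}(N)<w^{ -1}(M_k)$, $\mathfrak{p}_k(w)=\{N,M_k,m_k\}$ (an $N$-occurrence of $321$); (II) if $w^{ -1}(N)>w^{ -1}(M_k)$ and $\overline{w}(k)>m_k$,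 $\mathfrak{p}_k(w)=\{N,\overline{w}(k),m_k\}$ (an $N$-occurrence of $321$); (III) otherwise $\mathfrak{p}_k(w)=\{M_k,N,\overline{w}(k),m_k\}$ (an $N$-occurrence of $3412$). -}

module Defs where

-- Conventions (0-indexed encoding of the paper's 1-indexed notions):
--   * w ∈ 𝔖_N with N = suc n is  w : Permutation′ (suc n);  one-line notation
--     w(i) is  w ⟨$⟩ʳ i ;  position p (paper, 1-indexed) is Fin-index p-1,
--     value v (paper) is Fin-value v-1.  The letter N is  fromℕ n .
--   * the paper's simple reflection s_k of 𝔖_{m+1} (1 ≤ k ≤ m) is indexed by
--     j : Fin m with k = toℕ j + 1; it swaps Fin-values inject₁ j and suc j.

open import Data.Nat as ℕ using (ℕ; zero; suc; _≤_; _<_)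
open import Data.Bool using (if_then_else_)
open import Data.Empty using (⊥)
open import Data.Product using (Σ; ∃; _×_; _,_)
open import Data.List using (List; []; _∷_; length; map; filter; foldr)
open import Data.List.Membership.Propositional using () renaming (_∈_ to _∈ₗ_)
open import Data.Fin as F using (Fin; zero; suc; toℕ; inject₁; fromℕ)
open import Data.Fin.Permutation using (Permutation′; _⟨$⟩ʳ_; _⟨$⟩ˡ_; remove)
import Data.Fin.Permutation.Components as PC
open import Data.Fin.Subset using (Subset; _∈_; ⁅_⁆; _∪_)
open import Data.List using (allFin)
open import Relation.Nullary using (does)
open import Relation.Binary.PropositionalEquality using (_≡_)
open import Function.Bundles using (_⇔_)

simpleRefl : ∀ {m} → Fin m → Fin (suc m) → Fin (suc m)
simpleRefl j = PC.transpose (inject₁ j) (suc j)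

evalWord : ∀ {m} → List (Fin m) → Fin (suc m) → Fin (suc m)
evalWord []       x = x
evalWord (j ∷ js) x = simpleRefl j (evalWord js x)

IsWordFor : ∀ {m} → List (Fin m) → Permutation′ (suc m) → Set
IsWordFor ws u = ∀ x → evalWord ws x ≡ u ⟨$⟩ʳ x

IsReduced : ∀ {m} → List (Fin m) → Permutation′ (suc m) → Set
IsReduced ws u = IsWordFor ws u × (∀ vs → IsWordFor vs u → length ws ≤ length vs)

InSupp : ∀ {m} → Permutation′ (suc m) → Fin m → Set
InSupp u j = ∃ λ ws → IsReduced ws u × j ∈ₗ ws

topVal : ∀ {n} → Fin (suc n)
topVal {n} = fromℕ n

posTop : ∀ {n} → Permutation′ (suc n) → Fin (suc n)
posTop w = w ⟨$⟩ˡ topVal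

wbar : ∀ {n} → Permutation′ (suc n) → Permutation′ n
wbar w = remove (posTop w) w

maxF : ∀ {n} → Fin n → Fin n → Fin n
maxF a b = if does (toℕ a ℕ.≤? toℕ b) then b else a

minF : ∀ {n} → Fin n → Fin n → Fin n
minF a b = if does (toℕ a ℕ.≤? toℕ b) then a else b

-- M_k(u) = max { u(1), …, u(k) }  (Fin-positions 0 … toℕ j; position 0 is
-- used as seed, which lies in the range)
Mk : ∀ {m} → Permutation′ (suc m) → Fin m → Fin (suc m)
Mk u j = foldr maxF (u ⟨$⟩ʳ zero)
  (map (u ⟨$⟩ʳ_) (filter (λ i → toℕ i ℕ.≤? toℕ j) (allFin _)))

-- m_k(u) = min { u(k+1), …, u(m+1) }  (Fin-positions > toℕ j; the last
-- position fromℕ m is used as seed, which lies in the range)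
mk : ∀ {m} → Permutation′ (suc m) → Fin m → Fin (suc m)
mk {m} u j = foldr minF (u ⟨$⟩ʳ fromℕ m)
  (map (u ⟨$⟩ʳ_) (filter (λ i → toℕ j ℕ.<? toℕ i) (allFin _)))

Letter : ℕ → Set
Letter zero    = ⊥
Letter (suc m) = Fin m

InNewrep : ∀ {n} → Permutation′ (suc n) → Letter n → Set
InNewrep {zero}  w ()
InNewrep {suc m} w j = InSupp (wbar w) j × toℕ (posTop w) ≤ toℕ j

-- 𝔭_k(w), as a set of values of w (values of w̄ are embedded by inject₁)
pk : ∀ {n} → Permutation′ (suc n) → Letter n → Subset (suc n)
pk {zero}  w ()
pk {suc m} w j =
  if does (toℕ (posTop w) ℕ.<? toℕ (w ⟨$⟩ˡ M))
  then ⁅ topVal ⁆ ∪ ⁅ M ⁆ ∪ ⁅ mm ⁆                          -- (I)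
  else (if does (toℕ mm ℕ.<? toℕ wk)
        then ⁅ topVal ⁆ ∪ ⁅ wk ⁆ ∪ ⁅ mm ⁆                   -- (II)
        else ⁅ M ⁆ ∪ ⁅ topVal ⁆ ∪ ⁅ wk ⁆ ∪ ⁅ mm ⁆)           -- (III)
  where
  M  = inject₁ (Mk (wbar w) j)
  mm = inject₁ (mk (wbar w) j)
  wk = inject₁ (wbar w ⟨$⟩ʳ inject₁ j)

-- Pattern occurrences (identified with their sets of values)

IsOcc : ∀ {N r} → Permutation′ N → (Fin r → Fin r) → Subset N → Set
IsOcc {N} {r} w p S =
  Σ (Fin r → Fin N) λ i →
    (∀ a b → a F.< b → i a F.< i b) ×
    (∀ a b → (w ⟨$⟩ʳ i a F.< w ⟨$⟩ʳ i b) ⇔ (p a F.< p b)) ×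
    (∀ v → v ∈ S ⇔ ∃ λ a → w ⟨$⟩ʳ i a ≡ v)

IsLargest : ∀ {N} → Subset N → Fin N → Set
IsLargest S v = v ∈ S × (∀ u → u ∈ S → u F.≤ v)

IsNOcc : ∀ {n r} → Permutation′ (suc n) → (Fin r → Fin r) → Subset (suc n) → Set
IsNOcc w p S = IsOcc w p S × IsLargest S topVal

pat321 : Fin 3 → Fin 3
pat321 a = F.opposite a

pat4321 : Fin 4 → Fin 4
pat4321 a = F.opposite a

module Submission where

-- Let k < k′ with 𝔭_k = 𝔭_{k′}, and read positions in w̄, so that N stands just before
-- position w⁻¹(N). Apart from N, every value of 𝔭_k is w̄(i) for some i ≤ k, or is m_k. The
-- value m_{k′} sits at some c > k′ > k, so it equals m_k; this excludes cases (II) and (III) for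
-- k′ (they would put w̄(k′) = m_k too), hence M_{k′} ∈ 𝔭_k sits at some a ≤ k, and case (I)
-- places a after N. So a < k′ < c carry M_{k′} > w̄(k′) > m_{k′}, and {N, M_{k′}, w̄(k′)},
-- {N, w̄(k′), m_{k′}} are N-occurrences of 321. Every 𝔭_j contains m_j, which has no smaller
-- value to its right: this excludes the first set, and for the second forces m_j = m_{k′};
-- then M_j or w̄(j) would lie in it as well, which M_{k′} dominating the prefix up to k′ forbids.

open import Defs
open import Data.Nat as ℕ using (zero; suc; z≤n; s≤s)
open import Data.Nat.Properties as ℕ using (≰⇒>; ∸-monoʳ-<; ∸-cancelʳ-<)
open import Data.Bool using (if_then_else_)
open import Data.Empty using (⊥; ⊥-elim)
open import Data.Sum using (_⊎_; inj₁; inj₂; [_,_]′; map₁; map₂)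
open import Data.Product using (∃; ∃₂; _×_; _,_; proj₁; proj₂)
open import Data.List using (List; _∷_; map; filter; foldr; allFin)
open import Data.List.Properties using (foldr-preservesᵇ; foldr-preservesᵒ)
open import Data.List.Membership.Propositional using () renaming (_∈_ to _∈ₗ_)
open import Data.List.Membership.Propositional.Properties using (∈-map∘filter⁺; ∈-map∘filter⁻; ∈-allFin)
open import Data.List.Relation.Unary.Any as Any using (here; there)
import Data.List.Relation.Unary.All as All
open import Data.Fin as F using (Fin; zero; suc; toℕ; inject₁; fromℕ; punchIn; punchOut)
open import Data.Fin.Properties as F
  using (toℕ-injective; toℕ<n; ≤fromℕ; fromℕ≢inject₁; inject₁-injective; punchIn-punchOut; opposite-prop)
open import Data.Fin.Permutation using (Permutation′; _⟨$⟩ʳ_; _⟨$⟩ˡ_; inverseˡ; inverseʳ)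
open import Data.Fin.Subset using (Subset; _∈_; _∉_; ⁅_⁆; _∪_)
open import Data.Fin.Subset.Properties using (x∈⁅x⁆; x∈⁅y⁆⇒x≡y; x∈p∪q⁻; x∈p∪q⁺)
open import Relation.Nullary using (Dec; yes; no; does; ¬_)
open import Relation.Binary using (Rel; Reflexive; Transitive; tri<; tri≈; tri>)
open import Relation.Binary.PropositionalEquality
open import Function using (flip; _∘_)
open import Function.Bundles using (_⇔_; mk⇔; Equivalence; Injection)
open import Function.Properties.Inverse using (↔⇒↣)

if-dec-elim : ∀ {a p q} {A : Set a} {Q : Set q} (P : A → Set p) (d : Dec Q) {x y : A} →
  (Q → P x) → (¬ Q → P y) → P (if does d then x else y)
if-dec-elim P (yes q) onYes onNo = onYes q
if-dec-elim P (no ¬q) onYes onNo = onNo ¬q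

⟨$⟩ʳ-injective : ∀ {n} (π : Permutation′ n) {i j} → π ⟨$⟩ʳ i ≡ π ⟨$⟩ʳ j → i ≡ j
⟨$⟩ʳ-injective π = Injection.injective (↔⇒↣ π)

module _ {a} {A : Set a} (f : A → A → A) where

  foldr-selective-∈ : (∀ x y → f x y ≡ x ⊎ f x y ≡ y) → ∀ s xs → foldr f s xs ∈ₗ s ∷ xs
  foldr-selective-∈ selective s xs =
    foldr-preservesᵇ keep (here refl) (All.tabulate there)
    where
    keep : ∀ {x y} → x ∈ₗ s ∷ xs → y ∈ₗ s ∷ xs → f x y ∈ₗ s ∷ xs
    keep {x} {y} x∈ y∈ = [ (λ e → subst (_∈ₗ s ∷ xs) (sym e) x∈)
                         , (λ e → subst (_∈ₗ s ∷ xs) (sym e) y∈) ]′ (selective x y)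

  ∈⇒foldr-upper : ∀ {r} (R : Rel A r) → Reflexive R → Transitive R →
    (∀ x y → R x (f x y) × R y (f x y)) →
    ∀ {x} s xs → x ∈ₗ s ∷ xs → R x (foldr f s xs)
  ∈⇒foldr-upper R R-refl R-trans upper {x} s xs x∈ =
    foldr-preservesᵒ keep s xs (start x∈)
    where
    keep : ∀ y z → R x y ⊎ R x z → R x (f y z)
    keep y z (inj₁ xRy) = R-trans xRy (proj₁ (upper y z))
    keep y z (inj₂ xRz) = R-trans xRz (proj₂ (upper y z))
    start : x ∈ₗ s ∷ xs → R x s ⊎ Any.Any (R x) xs
    start (here refl) = inj₁ R-refl
    start (there x∈xs) = inj₂ (Any.map (λ { refl → R-refl }) x∈xs)

maxF-selective : ∀ {n} (x y : Fin n) → maxF x y ≡ x ⊎ maxF x y ≡ y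
maxF-selective x y =
  if-dec-elim (λ z → z ≡ x ⊎ z ≡ y) (toℕ x ℕ.≤? toℕ y) (λ _ → inj₂ refl) (λ _ → inj₁ refl)

minF-selective : ∀ {n} (x y : Fin n) → minF x y ≡ x ⊎ minF x y ≡ y
minF-selective x y =
  if-dec-elim (λ z → z ≡ x ⊎ z ≡ y) (toℕ x ℕ.≤? toℕ y) (λ _ → inj₁ refl) (λ _ → inj₂ refl)

maxF-upper : ∀ {n} (x y : Fin n) → x F.≤ maxF x y × y F.≤ maxF x y
maxF-upper x y = if-dec-elim (λ z → x F.≤ z × y F.≤ z) (toℕ x ℕ.≤? toℕ y)
  (λ x≤y → x≤y , ℕ.≤-refl) (λ x≰y → ℕ.≤-refl , ℕ.<⇒≤ (≰⇒> x≰y))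

minF-lower : ∀ {n} (x y : Fin n) → minF x y F.≤ x × minF x y F.≤ y
minF-lower x y = if-dec-elim (λ z → z F.≤ x × z F.≤ y) (toℕ x ℕ.≤? toℕ y)
  (λ x≤y → ℕ.≤-refl , x≤y) (λ x≰y → ℕ.<⇒≤ (≰⇒> x≰y) , ℕ.≤-refl)

module _ {m} (u : Permutation′ (suc m)) (j : Fin m) where

  private
    prefix suffix : List (Fin (suc m))
    prefix = filter (λ i → toℕ i ℕ.≤? toℕ j) (allFin (suc m))
    suffix = filter (λ i → toℕ j ℕ.<? toℕ i) (allFin (suc m))

  Mk-attained : ∃ λ i → toℕ i ℕ.≤ toℕ j × u ⟨$⟩ʳ i ≡ Mk u j
  Mk-attained with foldr-selective-∈ maxF maxF-selective (u ⟨$⟩ʳ zero) (map (u ⟨$⟩ʳ_) prefix)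
  ... | here e = zero , z≤n , sym e
  ... | there M∈ with ∈-map∘filter⁻ (u ⟨$⟩ʳ_) (λ i → toℕ i ℕ.≤? toℕ j) {xs = allFin (suc m)} M∈
  ...   | i , _ , e , i≤j = i , i≤j , sym e

  Mk-upper : ∀ i → toℕ i ℕ.≤ toℕ j → u ⟨$⟩ʳ i F.≤ Mk u j
  Mk-upper i i≤j =
    ∈⇒foldr-upper maxF F._≤_ ℕ.≤-refl ℕ.≤-trans maxF-upper (u ⟨$⟩ʳ zero) (map (u ⟨$⟩ʳ_) prefix)
    (there (∈-map∘filter⁺ (u ⟨$⟩ʳ_) (λ i → toℕ i ℕ.≤? toℕ j) (i , ∈-allFin i , refl , i≤j)))

  mk-attained : ∃ λ i → toℕ j ℕ.< toℕ i × u ⟨$⟩ʳ i ≡ mk u j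
  mk-attained with foldr-selective-∈ minF minF-selective (u ⟨$⟩ʳ fromℕ m) (map (u ⟨$⟩ʳ_) suffix)
  ... | here e = fromℕ m , subst (toℕ j ℕ.<_) (sym (F.toℕ-fromℕ m)) (toℕ<n j) , sym e
  ... | there m∈ with ∈-map∘filter⁻ (u ⟨$⟩ʳ_) (λ i → toℕ j ℕ.<? toℕ i) {xs = allFin (suc m)} m∈
  ...   | i , _ , e , j<i = i , j<i , sym e

  mk-lower : ∀ i → toℕ j ℕ.< toℕ i → mk u j F.≤ u ⟨$⟩ʳ i
  mk-lower i j<i =
    ∈⇒foldr-upper minF (flip F._≤_) ℕ.≤-refl (flip ℕ.≤-trans) minF-lower
      (u ⟨$⟩ʳ fromℕ m) (map (u ⟨$⟩ʳ_) suffix)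
    (there (∈-map∘filter⁺ (u ⟨$⟩ʳ_) (λ i → toℕ j ℕ.<? toℕ i) (i , ∈-allFin i , refl , j<i)))

  Mk-position : ∀ {i} → u ⟨$⟩ʳ i ≡ Mk u j → toℕ i ℕ.≤ toℕ j
  Mk-position {i} e with Mk-attained
  ... | i′ , i′≤j , e′ = subst (λ z → toℕ z ℕ.≤ toℕ j) (⟨$⟩ʳ-injective u (trans e′ (sym e))) i′≤j

  mk-position : ∀ {i} → u ⟨$⟩ʳ i ≡ mk u j → toℕ j ℕ.< toℕ i
  mk-position {i} e with mk-attained
  ... | i′ , j<i′ , e′ = subst (λ z → toℕ j ℕ.< toℕ z) (⟨$⟩ʳ-injective u (trans e′ (sym e))) j<i′

  mk-≤-later : ∀ {i i′} → u ⟨$⟩ʳ i ≡ mk u j → toℕ i ℕ.< toℕ i′ → u ⟨$⟩ʳ i F.≤ u ⟨$⟩ʳ i′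
  mk-≤-later e i<i′ = subst (F._≤ _) (sym e) (mk-lower _ (ℕ.<-trans (mk-position e) i<i′))

opposite-<-reverse : ∀ {r} {i j : Fin r} → i F.< j → F.opposite j F.< F.opposite i
opposite-<-reverse {i = i} {j} i<j =
  subst₂ ℕ._<_ (sym (opposite-prop j)) (sym (opposite-prop i)) (∸-monoʳ-< (s≤s i<j) (toℕ<n j))

opposite-<-reflect : ∀ {r} {i j : Fin r} → F.opposite j F.< F.opposite i → i F.< j
opposite-<-reflect {r} {i} {j} opp<opp =
  ℕ.s≤s⁻¹ (∸-cancelʳ-< {o = r} (subst₂ ℕ._<_ (opposite-prop j) (opposite-prop i) opp<opp))

strictlyDecreasing⇒<⇔opposite< : ∀ {r n} (f : Fin r → Fin n) → (∀ i j → i F.< j → f j F.< f i) →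
  ∀ i j → (f i F.< f j) ⇔ (F.opposite i F.< F.opposite j)
strictlyDecreasing⇒<⇔opposite< f decreasing i j = mk⇔ to (decreasing j i ∘ opposite-<-reflect)
  where
  to : f i F.< f j → F.opposite i F.< F.opposite j
  to fi<fj with F.<-cmp i j
  ... | tri< i<j _ _ = ⊥-elim (ℕ.<-asym fi<fj (decreasing i j i<j))
  ... | tri≈ _ refl _ = ⊥-elim (ℕ.<-irrefl refl fi<fj)
  ... | tri> _ _ j<i = opposite-<-reverse j<i

module _ {a r} {A : Set a} (R : Rel A r) (R-trans : Transitive R) (f : Fin 3 → A)
         (R₀₁ : R (f zero) (f (suc zero))) (R₁₂ : R (f (suc zero)) (f (suc (suc zero)))) where

  chain₃ : ∀ i j → i F.< j → R (f i) (f j)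
  chain₃ zero             (suc zero)       _ = R₀₁
  chain₃ zero             (suc (suc zero)) _ = R-trans R₀₁ R₁₂
  chain₃ (suc zero)       (suc (suc zero)) _ = R₁₂
  chain₃ zero             zero             ()
  chain₃ (suc zero)       zero             ()
  chain₃ (suc zero)       (suc zero)       (s≤s ())
  chain₃ (suc (suc zero)) zero             ()
  chain₃ (suc (suc zero)) (suc zero)       (s≤s ())
  chain₃ (suc (suc zero)) (suc (suc zero)) (s≤s (s≤s ()))

toℕ-punchIn-≥ : ∀ {n} (i : Fin (suc n)) (j : Fin n) → toℕ i ℕ.≤ toℕ j → toℕ (punchIn i j) ≡ suc (toℕ j)
toℕ-punchIn-≥ zero    j       _         = refl
toℕ-punchIn-≥ (suc i) (suc j) (s≤s i≤j) = cong suc (toℕ-punchIn-≥ i j i≤j)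

punchIn->⇒≥ : ∀ {n} (i : Fin (suc n)) (j : Fin n) → toℕ i ℕ.< toℕ (punchIn i j) → toℕ i ℕ.≤ toℕ j
punchIn->⇒≥ zero    j       _         = z≤n
punchIn->⇒≥ (suc i) zero    ()
punchIn->⇒≥ (suc i) (suc j) (s≤s i<j) = s≤s (punchIn->⇒≥ i j i<j)

punchIn-fromℕ : ∀ {n} (j : Fin n) → punchIn (fromℕ n) j ≡ inject₁ j
punchIn-fromℕ zero    = refl
punchIn-fromℕ (suc j) = cong suc (punchIn-fromℕ j)

inject₁-punchOut : ∀ {n} {i j : Fin (suc n)} (i≢j : i ≢ j) → i ≡ fromℕ n → inject₁ (punchOut i≢j) ≡ j
inject₁-punchOut i≢j refl = trans (sym (punchIn-fromℕ (punchOut i≢j))) (punchIn-punchOut i≢j)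

module _ {n} (w : Permutation′ (suc n)) where

  w-posTop : w ⟨$⟩ʳ posTop w ≡ topVal
  w-posTop = inverseʳ w

  w-punchIn : ∀ i → w ⟨$⟩ʳ punchIn (posTop w) i ≡ inject₁ (wbar w ⟨$⟩ʳ i)
  w-punchIn i = sym (inject₁-punchOut _ w-posTop)

  w⁻¹-inject₁ : ∀ i → w ⟨$⟩ˡ inject₁ (wbar w ⟨$⟩ʳ i) ≡ punchIn (posTop w) i
  w⁻¹-inject₁ i = trans (cong (w ⟨$⟩ˡ_) (sym (w-punchIn i))) (inverseˡ w)

Triple : ∀ {n} → Fin n → Fin n → Fin n → Subset n
Triple x y z = ⁅ x ⁆ ∪ ⁅ y ⁆ ∪ ⁅ z ⁆

∈⁅⁆∪⁻ : ∀ {n} {v x : Fin n} {S : Subset n} → v ∈ ⁅ x ⁆ ∪ S → v ≡ x ⊎ v ∈ S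
∈⁅⁆∪⁻ {x = x} {S} v∈ = map₁ (x∈⁅y⁆⇒x≡y x) (x∈p∪q⁻ ⁅ x ⁆ S v∈)

∈-Triple⁻ : ∀ {n} (x y z : Fin n) {v} → v ∈ Triple x y z → v ≡ x ⊎ v ≡ y ⊎ v ≡ z
∈-Triple⁻ x y z v∈ with ∈⁅⁆∪⁻ v∈
... | inj₁ v≡x = inj₁ v≡x
... | inj₂ v∈′ = inj₂ (map₂ (x∈⁅y⁆⇒x≡y z) (∈⁅⁆∪⁻ v∈′))

∈-Triple⁺ : ∀ {n} (x y z : Fin n) {v} → v ≡ x ⊎ v ≡ y ⊎ v ≡ z → v ∈ Triple x y z
∈-Triple⁺ x y z (inj₁ refl)        = x∈p∪q⁺ (inj₁ (x∈⁅x⁆ x))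
∈-Triple⁺ x y z (inj₂ (inj₁ refl)) = x∈p∪q⁺ (inj₂ (x∈p∪q⁺ (inj₁ (x∈⁅x⁆ y))))
∈-Triple⁺ x y z (inj₂ (inj₂ refl)) = x∈p∪q⁺ (inj₂ (x∈p∪q⁺ (inj₂ (x∈⁅x⁆ z))))

triple : ∀ {a} {A : Set a} → A → A → A → Fin 3 → A
triple x y z zero             = x
triple x y z (suc zero)       = y
triple x y z (suc (suc zero)) = z

∈-Triple⇔ : ∀ {n} (x y z : Fin n) {v} → v ∈ Triple x y z ⇔ ∃ λ i → triple x y z i ≡ v
∈-Triple⇔ x y z = mk⇔ (witness ∘ ∈-Triple⁻ x y z) (∈-Triple⁺ x y z ∘ entry)
  where
  witness : ∀ {v} → v ≡ x ⊎ v ≡ y ⊎ v ≡ z → ∃ λ i → triple x y z i ≡ v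
  witness (inj₁ refl)        = zero , refl
  witness (inj₂ (inj₁ refl)) = suc zero , refl
  witness (inj₂ (inj₂ refl)) = suc (suc zero) , refl
  entry : ∀ {v} → (∃ λ i → triple x y z i ≡ v) → v ≡ x ⊎ v ≡ y ⊎ v ≡ z
  entry (zero , refl)           = inj₁ refl
  entry (suc zero , refl)       = inj₂ (inj₁ refl)
  entry (suc (suc zero) , refl) = inj₂ (inj₂ refl)

module _ {m} (w : Permutation′ (suc (suc m))) where

  private
    u : Permutation′ (suc m)
    u = wbar w

    p : Fin (suc (suc m))
    p = posTop w

    lift : Fin (suc m) → Fin (suc (suc m))
    lift i = inject₁ (u ⟨$⟩ʳ i)

    M′ m′ wk′ : Fin m → Fin (suc (suc m))
    M′ j  = inject₁ (Mk u j)
    m′ j  = inject₁ (mk u j)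
    wk′ j = lift (inject₁ j)

    u-distinct : ∀ {i i′} → i F.< i′ → u ⟨$⟩ʳ i ≢ u ⟨$⟩ʳ i′
    u-distinct i<i′ e = ℕ.<-irrefl (cong toℕ (⟨$⟩ʳ-injective u e)) i<i′

    lift-distinct : ∀ {i i′} → i F.< i′ → lift i ≢ lift i′
    lift-distinct i<i′ = u-distinct i<i′ ∘ inject₁-injective

    wk′-injective : ∀ {j : Fin m} {i} → wk′ j ≡ lift i → toℕ j ≡ toℕ i
    wk′-injective {j} e = trans (sym (F.toℕ-inject₁ j)) (cong toℕ (⟨$⟩ʳ-injective u (inject₁-injective e)))

    inject₁≢topVal : ∀ {x : Fin (suc m)} → inject₁ x ≢ topVal
    inject₁≢topVal = fromℕ≢inject₁ ∘ sym

  CaseI : Fin m → Set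
  CaseI j = toℕ p ℕ.< toℕ (w ⟨$⟩ˡ M′ j)

  CaseI? : ∀ j → Dec (CaseI j)
  CaseI? j = toℕ p ℕ.<? toℕ (w ⟨$⟩ˡ M′ j)

  pk-elim : ∀ {ℓ} (P : Subset (suc (suc m)) → Set ℓ) j →
    (CaseI j → P (Triple topVal (M′ j) (m′ j))) →
    (¬ CaseI j → P (Triple topVal (wk′ j) (m′ j))) →
    (¬ CaseI j → P (⁅ M′ j ⁆ ∪ Triple topVal (wk′ j) (m′ j))) →
    P (pk w j)
  pk-elim P j caseI caseII caseIII =
    if-dec-elim P (CaseI? j) caseI λ ¬I →
      if-dec-elim P (toℕ (m′ j) ℕ.<? toℕ (wk′ j)) (λ _ → caseII ¬I) (λ _ → caseIII ¬I)

  ∈-pk⁻ : ∀ {v} j → v ∈ pk w j → v ≡ topVal ⊎ v ≡ M′ j ⊎ v ≡ wk′ j ⊎ v ≡ m′ j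
  ∈-pk⁻ {v} j = pk-elim (λ S → v ∈ S → v ≡ topVal ⊎ v ≡ M′ j ⊎ v ≡ wk′ j ⊎ v ≡ m′ j) j
    (λ _ → [ inj₁ , [ inj₂ ∘ inj₁ , inj₂ ∘ inj₂ ∘ inj₂ ]′ ]′ ∘ ∈-Triple⁻ topVal (M′ j) (m′ j))
    (λ _ → [ inj₁ , inj₂ ∘ inj₂ ]′ ∘ ∈-Triple⁻ topVal (wk′ j) (m′ j))
    (λ _ → [ inj₂ ∘ inj₁ , [ inj₁ , inj₂ ∘ inj₂ ]′ ∘ ∈-Triple⁻ topVal (wk′ j) (m′ j) ]′ ∘ ∈⁅⁆∪⁻)

  mk∈pk : ∀ j → m′ j ∈ pk w j
  mk∈pk j = pk-elim (m′ j ∈_) j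
    (λ _ → ∈-Triple⁺ topVal (M′ j) (m′ j) (inj₂ (inj₂ refl)))
    (λ _ → ∈-Triple⁺ topVal (wk′ j) (m′ j) (inj₂ (inj₂ refl)))
    (λ _ → x∈p∪q⁺ (inj₂ (∈-Triple⁺ topVal (wk′ j) (m′ j) (inj₂ (inj₂ refl)))))

  Mk∈pk : ∀ j → CaseI j → M′ j ∈ pk w j
  Mk∈pk j I = pk-elim (M′ j ∈_) j
    (λ _ → ∈-Triple⁺ topVal (M′ j) (m′ j) (inj₂ (inj₁ refl)))
    (λ ¬I → ⊥-elim (¬I I)) (λ ¬I → ⊥-elim (¬I I))

  wk∈pk : ∀ j → ¬ CaseI j → wk′ j ∈ pk w j
  wk∈pk j ¬I = pk-elim (wk′ j ∈_) j (λ I → ⊥-elim (¬I I))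
    (λ _ → ∈-Triple⁺ topVal (wk′ j) (m′ j) (inj₂ (inj₁ refl)))
    (λ _ → x∈p∪q⁺ (inj₂ (∈-Triple⁺ topVal (wk′ j) (m′ j) (inj₂ (inj₁ refl)))))

  ∈-pk-beyond : ∀ {i} j → lift i ∈ pk w j → toℕ j ℕ.< toℕ i → u ⟨$⟩ʳ i ≡ mk u j
  ∈-pk-beyond {i} j i∈ j<i with ∈-pk⁻ j i∈
  ... | inj₁ e                  = ⊥-elim (inject₁≢topVal e)
  ... | inj₂ (inj₁ e)           = ⊥-elim (ℕ.<⇒≱ j<i (Mk-position u j (inject₁-injective e)))
  ... | inj₂ (inj₂ (inj₁ e))    = ⊥-elim (ℕ.<-irrefl (wk′-injective (sym e)) j<i)
  ... | inj₂ (inj₂ (inj₂ e))    = inject₁-injective e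

  CaseI⇔top-before : ∀ {a} j → u ⟨$⟩ʳ a ≡ Mk u j → CaseI j ⇔ toℕ p ℕ.≤ toℕ a
  CaseI⇔top-before {a} j e = mk⇔
    (punchIn->⇒≥ p a ∘ subst (toℕ p ℕ.<_) position≡)
    (λ p≤a → subst (toℕ p ℕ.<_) (trans (sym (toℕ-punchIn-≥ p a p≤a)) (sym position≡)) (s≤s p≤a))
    where
    position≡ : toℕ (w ⟨$⟩ˡ M′ j) ≡ toℕ (punchIn p a)
    position≡ = cong toℕ (trans (cong (λ v → w ⟨$⟩ˡ inject₁ v) (sym e)) (w⁻¹-inject₁ w a))

  occurrence321 : ∀ {a b} → toℕ p ℕ.≤ toℕ a → a F.< b → u ⟨$⟩ʳ b F.< u ⟨$⟩ʳ a →
    IsNOcc w pat321 (Triple topVal (lift a) (lift b))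
  occurrence321 {a} {b} p≤a a<b ub<ua =
    (position , increasing , strictlyDecreasing⇒<⇔opposite< ((w ⟨$⟩ʳ_) ∘ position) decreasing , members)
    , ∈-Triple⁺ topVal (lift a) (lift b) (inj₁ refl) , λ v _ → ≤fromℕ v
    where
    position value : Fin 3 → Fin (suc (suc m))
    position = triple p (punchIn p a) (punchIn p b)
    value    = triple topVal (lift a) (lift b)

    w∘position : ∀ i → w ⟨$⟩ʳ position i ≡ value i
    w∘position zero             = w-posTop w
    w∘position (suc zero)       = w-punchIn w a
    w∘position (suc (suc zero)) = w-punchIn w b

    toℕ-punchIn-b : toℕ (punchIn p b) ≡ suc (toℕ b)
    toℕ-punchIn-b = toℕ-punchIn-≥ p b (ℕ.≤-trans p≤a (ℕ.<⇒≤ a<b))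

    increasing : ∀ i j → i F.< j → position i F.< position j
    increasing = chain₃ F._<_ ℕ.<-trans position
      (subst (toℕ p ℕ.<_) (sym (toℕ-punchIn-≥ p a p≤a)) (s≤s p≤a))
      (subst₂ ℕ._<_ (sym (toℕ-punchIn-≥ p a p≤a)) (sym toℕ-punchIn-b) (s≤s a<b))

    lift<topVal : ∀ i → lift i F.< topVal
    lift<topVal i = F.≤∧≢⇒< (≤fromℕ (lift i)) inject₁≢topVal

    decreasing : ∀ i j → i F.< j → w ⟨$⟩ʳ position j F.< w ⟨$⟩ʳ position i
    decreasing i j i<j = subst₂ F._<_ (sym (w∘position j)) (sym (w∘position i))
      (chain₃ (flip F._<_) (flip ℕ.<-trans) value (lift<topVal a)
        (subst₂ ℕ._<_ (sym (F.toℕ-inject₁ _)) (sym (F.toℕ-inject₁ _)) ub<ua) i j i<j)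

    members : ∀ v → v ∈ Triple topVal (lift a) (lift b) ⇔ ∃ λ i → w ⟨$⟩ʳ position i ≡ v
    members v = mk⇔
      (λ v∈ → let i , e = Equivalence.to value-members v∈ in i , trans (w∘position i) e)
      (λ (i , e) → Equivalence.from value-members (i , trans (sym (w∘position i)) e))
      where
      value-members : v ∈ Triple topVal (lift a) (lift b) ⇔ ∃ λ i → value i ≡ v
      value-members = ∈-Triple⇔ topVal (lift a) (lift b)

  mk-not-before-smaller : ∀ j {i i′} → u ⟨$⟩ʳ i ≡ mk u j → i F.< i′ → u ⟨$⟩ʳ i′ F.< u ⟨$⟩ʳ i → ⊥
  mk-not-before-smaller j e i<i′ ui′<ui = ℕ.<⇒≱ ui′<ui (mk-≤-later u j e i<i′)

  -- In use, a, b and c are the positions in w̄ of M_{k′}, w̄(k′) and m_{k′}.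
  record Descent : Set where
    field
      a b c       : Fin (suc m)
      top-before  : toℕ p ℕ.≤ toℕ a
      a<b         : a F.< b
      b<c         : b F.< c
      ub<ua       : u ⟨$⟩ʳ b F.< u ⟨$⟩ʳ a
      uc<ub       : u ⟨$⟩ʳ c F.< u ⟨$⟩ʳ b
      ua-prefixMax : ∀ i → i F.≤ b → u ⟨$⟩ʳ i F.≤ u ⟨$⟩ʳ a

  descent-of-equal-pk : ∀ {k k′} → k F.< k′ → pk w k ≡ pk w k′ → Descent
  descent-of-equal-pk {k} {k′} k<k′ pk≡ with Mk-attained u k′ | mk-attained u k′
  ... | a , a≤k′ , ua≡M | c , k′<c , uc≡m = record
    { a = a ; b = b ; c = c ; top-before = top-before ; a<b = a<b ; b<c = b<c
    ; ub<ua = ub<ua ; uc<ub = uc<ub ; ua-prefixMax = ua-prefixMax }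
    where
    b : Fin (suc m)
    b = inject₁ k′

    toℕ-b : toℕ b ≡ toℕ k′
    toℕ-b = F.toℕ-inject₁ k′

    k<b : toℕ k ℕ.< toℕ b
    k<b = subst (toℕ k ℕ.<_) (sym toℕ-b) k<k′

    b<c : b F.< c
    b<c = subst (ℕ._< toℕ c) (sym toℕ-b) k′<c

    ∈pk-k : ∀ {v} → v ∈ pk w k′ → v ∈ pk w k
    ∈pk-k = subst (_ ∈_) (sym pk≡)

    uc≡mk : u ⟨$⟩ʳ c ≡ mk u k
    uc≡mk = ∈-pk-beyond k (∈pk-k (subst (λ v → inject₁ v ∈ pk w k′) (sym uc≡m) (mk∈pk k′)))
      (ℕ.<-trans k<k′ k′<c)

    caseI : CaseI k′
    caseI with CaseI? k′
    ... | yes I = I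
    ... | no ¬I = ⊥-elim (u-distinct b<c (trans ub≡mk (sym uc≡mk)))
      where
      ub≡mk : u ⟨$⟩ʳ b ≡ mk u k
      ub≡mk = ∈-pk-beyond k (∈pk-k (wk∈pk k′ ¬I)) k<b

    a≤k : toℕ a ℕ.≤ toℕ k
    a≤k with toℕ a ℕ.≤? toℕ k
    ... | yes a≤k = a≤k
    ... | no a≰k = ⊥-elim (u-distinct (ℕ.≤-<-trans a≤k′ k′<c) (trans ua≡mk (sym uc≡mk)))
      where
      ua≡mk : u ⟨$⟩ʳ a ≡ mk u k
      ua≡mk = ∈-pk-beyond k (∈pk-k (subst (λ v → inject₁ v ∈ pk w k′) (sym ua≡M) (Mk∈pk k′ caseI)))
        (≰⇒> a≰k)

    top-before : toℕ p ℕ.≤ toℕ a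
    top-before = Equivalence.to (CaseI⇔top-before k′ ua≡M) caseI

    a<b : a F.< b
    a<b = ℕ.≤-<-trans a≤k k<b

    ua-prefixMax : ∀ i → i F.≤ b → u ⟨$⟩ʳ i F.≤ u ⟨$⟩ʳ a
    ua-prefixMax i i≤b = subst (u ⟨$⟩ʳ i F.≤_) (sym ua≡M) (Mk-upper u k′ i (subst (toℕ i ℕ.≤_) toℕ-b i≤b))

    ub<ua : u ⟨$⟩ʳ b F.< u ⟨$⟩ʳ a
    ub<ua = F.≤∧≢⇒< (ua-prefixMax b ℕ.≤-refl) (u-distinct a<b ∘ sym)

    uc<ub : u ⟨$⟩ʳ c F.< u ⟨$⟩ʳ b
    uc<ub = F.≤∧≢⇒< (subst (F._≤ u ⟨$⟩ʳ b) (sym uc≡mk) (mk-lower u k b k<b)) (u-distinct b<c ∘ sym)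

  module _ (D : Descent) where
    open Descent D

    private
      S T : Subset (suc (suc m))
      S = Triple topVal (lift a) (lift b)
      T = Triple topVal (lift b) (lift c)

      uc<ua : u ⟨$⟩ʳ c F.< u ⟨$⟩ʳ a
      uc<ua = ℕ.<-trans uc<ub ub<ua

      a<c : a F.< c
      a<c = ℕ.<-trans a<b b<c

    la∉T : lift a ∉ T
    la∉T la∈T with ∈-Triple⁻ topVal (lift b) (lift c) la∈T
    ... | inj₁ e        = inject₁≢topVal e
    ... | inj₂ (inj₁ e) = lift-distinct a<b e
    ... | inj₂ (inj₂ e) = lift-distinct a<c e

    mk∉S : ∀ j → m′ j ∉ S
    mk∉S j mk∈S with ∈-Triple⁻ topVal (lift a) (lift b) mk∈S
    ... | inj₁ e        = inject₁≢topVal e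
    ... | inj₂ (inj₁ e) = mk-not-before-smaller j (sym (inject₁-injective e)) a<c uc<ua
    ... | inj₂ (inj₂ e) = mk-not-before-smaller j (sym (inject₁-injective e)) b<c uc<ub

    ua≡Mk : ∀ {j} → toℕ j ≡ toℕ b → u ⟨$⟩ʳ a ≡ Mk u j
    ua≡Mk {j} j≡b with Mk-attained u j
    ... | i , i≤j , ui≡M = toℕ-injective (ℕ.≤-antisym
      (Mk-upper u j a (ℕ.<⇒≤ (subst (toℕ a ℕ.<_) (sym j≡b) a<b)))
      (subst (F._≤ u ⟨$⟩ʳ a) ui≡M (ua-prefixMax i (subst (toℕ i ℕ.≤_) j≡b i≤j))))

    Mk∉T : ∀ {j} → u ⟨$⟩ʳ c ≡ mk u j → M′ j ∉ T
    Mk∉T {j} uc≡mk M∈T with ∈-Triple⁻ topVal (lift b) (lift c) M∈T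
    ... | inj₁ e        = inject₁≢topVal e
    ... | inj₂ (inj₁ e) = ℕ.<⇒≱ ub<ua
      (subst (u ⟨$⟩ʳ a F.≤_) (inject₁-injective e) (Mk-upper u j a (ℕ.<⇒≤ (ℕ.<-≤-trans a<b b≤j))))
      where
      b≤j : toℕ b ℕ.≤ toℕ j
      b≤j = Mk-position u j (sym (inject₁-injective e))
    ... | inj₂ (inj₂ e) = ℕ.<⇒≱ (mk-position u j uc≡mk) (Mk-position u j (sym (inject₁-injective e)))

    wk∉T : ∀ {j} → ¬ CaseI j → u ⟨$⟩ʳ c ≡ mk u j → wk′ j ∉ T
    wk∉T {j} ¬I uc≡mk wk∈T with ∈-Triple⁻ topVal (lift b) (lift c) wk∈T
    ... | inj₁ e        = inject₁≢topVal e
    ... | inj₂ (inj₁ e) =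
      ¬I (Equivalence.from (CaseI⇔top-before j (ua≡Mk (wk′-injective e))) top-before)
    ... | inj₂ (inj₂ e) = ℕ.<-irrefl (wk′-injective e) (mk-position u j uc≡mk)

    S≢T : S ≢ T
    S≢T S≡T = la∉T (subst (lift a ∈_) S≡T (∈-Triple⁺ topVal (lift a) (lift b) (inj₂ (inj₁ refl))))

    S≢pk : ∀ j → S ≢ pk w j
    S≢pk j S≡ = mk∉S j (subst (m′ j ∈_) (sym S≡) (mk∈pk j))

    T≢pk : ∀ j → T ≢ pk w j
    T≢pk j T≡ with ∈-Triple⁻ topVal (lift b) (lift c) (subst (m′ j ∈_) (sym T≡) (mk∈pk j))
    ... | inj₁ e        = inject₁≢topVal e
    ... | inj₂ (inj₁ e) = mk-not-before-smaller j (sym (inject₁-injective e)) b<c uc<ub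
    ... | inj₂ (inj₂ e) with CaseI? j
    ...   | yes I  = Mk∉T (sym (inject₁-injective e)) (subst (M′ j ∈_) (sym T≡) (Mk∈pk j I))
    ...   | no ¬I  = wk∉T ¬I (sym (inject₁-injective e)) (subst (wk′ j ∈_) (sym T≡) (wk∈pk j ¬I))

    fresh-321-pair : ∃₂ λ S T → S ≢ T × IsNOcc w pat321 S × IsNOcc w pat321 T ×
                                (∀ j → S ≢ pk w j) × (∀ j → T ≢ pk w j)
    fresh-321-pair = S , T , S≢T
      , occurrence321 top-before a<b ub<ua
      , occurrence321 (ℕ.≤-trans top-before (ℕ.<⇒≤ a<b)) b<c uc<ub
      , S≢pk , T≢pk

  descent-of-distinct-equal-pk : ∀ {k k′} → k ≢ k′ → pk w k ≡ pk w k′ → Descent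
  descent-of-distinct-equal-pk {k} {k′} k≢k′ pk≡ with F.<-cmp k k′
  ... | tri< k<k′ _ _ = descent-of-equal-pk k<k′ pk≡
  ... | tri≈ _ k≡k′ _ = ⊥-elim (k≢k′ k≡k′)
  ... | tri> _ _ k′<k = descent-of-equal-pk k′<k (sym pk≡)

proposition4p1p4 : ∀ {n} (w : Permutation′ (suc n)) →
    (∃ λ S → IsNOcc w pat4321 S) →
    (∃ λ k → ∃ λ k' → k ≢ k' × InNewrep w k × InNewrep w k' × pk w k ≡ pk w k') →
    ∃ λ (S : Subset (suc n)) → ∃ λ (T : Subset (suc n)) →
      S ≢ T × IsNOcc w pat321 S × IsNOcc w pat321 T ×
      (∀ j → InNewrep w j → S ≢ pk w j) ×
      (∀ j → InNewrep w j → T ≢ pk w j)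
proposition4p1p4 {zero}  w _ (() , _)
proposition4p1p4 {suc m} w _ (k , k′ , k≢k′ , _ , _ , pk≡) =
  let S , T , S≢T , occS , occT , S-fresh , T-fresh =
        fresh-321-pair w (descent-of-distinct-equal-pk w k≢k′ pk≡)
  in S , T , S≢T , occS , occT , (λ j _ → S-fresh j) , (λ j _ → T-fresh j)
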